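{- Let $G$ be a finite group and $H$ a subgroup of $G$. If $C$ is a subset of $H$ with $|H|>|C|>2[G:H]\,|H\setminus C|$, then $C$ is not a minimal complement to any subset of $G$. Equivalently, no subset $C$ of $H$ satisfying $$|H|\frac{2[G:H]}{1+2[G:H]}=\frac{2|G||H|}{|H|+2|G|}<|C|<|H|$$ is a minimal complement to some subset of $G$. In particular, if $C$ is a proper subset of $G$ with more than $2|G\setminus C|$ elements, then $C$ is not a minimal complement in $G$.
   Context: For nonempty subsets $A,B$ of a group $G$, write $A\cdot B=\{ab: a\in A, b\in B\}$. $A$ is a left complement to $B$ if $A\cdot B=G$, and a right complement to $B$ if $B\cdot A=G$. $A$ is a minimal left (resp. right) complement to $B$ if $A$ is a left (resp. right) complement to $B$ and no proper subset of $A$ is a left (resp. right) complement to $B$. A subset is a minimal complement (in $G$ / to some subset) if it is a minimal left or minimal right complement to some nonempty subset of $G$. -}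

module Defs where

open import Data.Nat using (ℕ)
open import Data.Fin using (Fin)
open import Data.Fin.Subset using (Subset; _∈_; _⊂_; Nonempty)
open import Data.Product using (Σ; ∃; _×_; _,_)
open import Data.Sum using (_⊎_)
open import Relation.Nullary using (¬_)
open import Relation.Binary.PropositionalEquality using (_≡_)
open import Algebra.Core using (Op₁; Op₂)
open import Algebra.Structures using (IsGroup)

-- A finite group of order n: a group structure on Fin n
-- (every finite group is isomorphic to one of these).
record FinGroup (n : ℕ) : Set where
  field
    _∙_     : Op₂ (Fin n)
    ε       : Fin n
    _⁻¹     : Op₁ (Fin n)
    isGroup : IsGroup _≡_ _∙_ ε _⁻¹

module _ {n : ℕ} (G : FinGroup n) where
  open FinGroup G

  IsSubgroup : Subset n → Set
  IsSubgroup H = (ε ∈ H)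
               × (∀ {x y} → x ∈ H → y ∈ H → (x ∙ y) ∈ H)
               × (∀ {x} → x ∈ H → (x ⁻¹) ∈ H)

  IsLeftComplement : Subset n → Subset n → Set
  IsLeftComplement A B =
    ∀ g → ∃ λ a → ∃ λ b → a ∈ A × b ∈ B × (a ∙ b) ≡ g

  IsRightComplement : Subset n → Subset n → Set
  IsRightComplement A B =
    ∀ g → ∃ λ b → ∃ λ a → b ∈ B × a ∈ A × (b ∙ a) ≡ g

  IsMinimalLeftComplement : Subset n → Subset n → Set
  IsMinimalLeftComplement A B =
    IsLeftComplement A B × (∀ A′ → A′ ⊂ A → ¬ IsLeftComplement A′ B)

  IsMinimalRightComplement : Subset n → Subset n → Set
  IsMinimalRightComplement A B =
    IsRightComplement A B × (∀ A′ → A′ ⊂ A → ¬ IsRightComplement A′ B)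

  IsMinimalComplement : Subset n → Set
  IsMinimalComplement C =
    Nonempty C × (∃ λ B → Nonempty B ×
      (IsMinimalLeftComplement C B ⊎ IsMinimalRightComplement C B))

module Submission where

-- If C ⊆ H ≤ G, H ⊈ C and C is a minimal left complement to B (C·B = G,
-- but (C - c)·B ≠ G for all c ∈ C), then |H|·|C| ≤ 2·|G|·|H ∖ C|; dividing
-- by |H| contradicts |C| > 2 [G:H] |H ∖ C|.  The bound comes from an injection
-- H × C → Fin 2 × G × (H ∖ C):
-- (1) minimality gives each c ∈ C an element g private to c: every
--     factorisation g = a·b (a ∈ C, b ∈ B) has a = c;
-- (2) each fibre B ∩ Hg has two elements (else H ⊆ C); we take the two least,
--     so the choice depends only on the coset Hg;
-- (3) for g private to c, one of them, b, has g·b⁻¹ ∈ H ∖ C;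
-- (4) (h , c) ↦ (which one , h·b , g·b⁻¹) is injective, since h·b determines Hg.
-- Right complements are left complements in the opposite group.

open import Defs
open import Data.Nat using (ℕ; _*_; _<_)
open import Data.Fin.Subset using (Subset; _⊆_; ∣_∣; _─_)
open import Relation.Nullary using (¬_)
open import Relation.Binary.PropositionalEquality using (_≡_)

open import Level using (Level; 0ℓ)
open import Data.Nat using (suc; _≤_; z≤n; s<s⁻¹; >-nonZero)
import Data.Nat.Properties as ℕ
open import Data.Nat.Tactic.RingSolver using (solve-∀)
open import Data.Fin as Fin using (Fin; zero; suc; combine; remQuot; _≟_)
open import Data.Fin.Properties using (suc-injective; <-cmp; any?; ¬∀⟶∃¬; injective⇒≤; combine-injective; combine-remQuot)
open import Data.Fin.Subset using (_∈_; _∉_; _-_; inside; outside)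
open import Data.Fin.Subset.Properties using (_∈?_; p⊆q⇒∣p∣≤∣q∣; x∈p∧x∉q⇒x∈p─q; x∈p∧x≢y⇒x∈p-y; x∈p⇒p-x⊂p)
open import Data.Vec using (_∷_; here; there)
open import Data.Product using (∃; _×_; _,_; proj₁; proj₂; uncurry)
open import Data.Sum using (_⊎_; inj₁; inj₂)
open import Data.Empty using (⊥-elim)
open import Function using (_∘_; flip)
open import Function.Definitions using (Injective)
open import Relation.Nullary using (Dec; yes; no; ¬?)
open import Relation.Nullary.Decidable using (_×-dec_; decidable-stable)
open import Relation.Unary using (Pred; Decidable)
open import Relation.Binary.Definitions using (tri<; tri≈; tri>)
open import Relation.Binary.PropositionalEquality using (refl; sym; trans; cong; cong₂; subst; _≢_; module ≡-Reasoning)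
open import Algebra.Bundles using (Group)
open import Algebra.Structures using (IsGroup)
import Algebra.Properties.Group as GroupProperties
import Algebra.Construct.Flip.Op as Flip

private
  variable
    ℓ : Level
    k m n t : ℕ

IsLeast : Pred (Fin n) ℓ → Fin n → Set ℓ
IsLeast P x = P x × (∀ {y} → y Fin.< x → ¬ P y)

-- Equivalent predicates have the same least element; this is what makes
-- the choices below depend only on a coset and not on its representative.
least-unique : {P Q : Pred (Fin n) ℓ} →
  (∀ {z} → P z → Q z) → (∀ {z} → Q z → P z) →
  ∀ {x y} → IsLeast P x → IsLeast Q y → x ≡ y
least-unique P⇒Q Q⇒P {x} {y} (Px , x-least) (Qy , y-least) with <-cmp x y
... | tri< x<y _ _ = ⊥-elim (y-least x<y (P⇒Q Px))
... | tri≈ _ x≡y _ = x≡y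
... | tri> _ _ y<x = ⊥-elim (x-least y<x (Q⇒P Qy))

least : {P : Pred (Fin n) ℓ} → Decidable P → ∃ P → ∃ (IsLeast P)
least {suc n} {P = P} P? witness with P? zero
... | yes P0 = zero , P0 , λ ()
... | no ¬P0 with witness
...   | zero , P0 = ⊥-elim (¬P0 P0)
...   | suc x , Px with least (P? ∘ suc) (x , Px)
...     | y , Py , y-least = suc y , Py , below
  where
  below : ∀ {z} → z Fin.< suc y → ¬ P z
  below {zero} _ = ¬P0
  below {suc z} z<y = y-least (s<s⁻¹ z<y)

element : (p : Subset n) → Fin ∣ p ∣ → Fin n
element (inside ∷ p) zero = zero
element (inside ∷ p) (suc i) = suc (element p i)
element (outside ∷ p) i = suc (element p i)

element-∈ : (p : Subset n) (i : Fin ∣ p ∣) → element p i ∈ p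
element-∈ (inside ∷ p) zero = here
element-∈ (inside ∷ p) (suc i) = there (element-∈ p i)
element-∈ (outside ∷ p) i = there (element-∈ p i)

element-injective : (p : Subset n) → Injective _≡_ _≡_ (element p)
element-injective (inside ∷ p) {zero} {zero} _ = refl
element-injective (inside ∷ p) {suc i} {suc j} e = cong suc (element-injective p (suc-injective e))
element-injective (outside ∷ p) e = element-injective p (suc-injective e)

position : {p : Subset n} {x : Fin n} → x ∈ p → Fin ∣ p ∣
position {p = inside ∷ p} here = zero
position {p = inside ∷ p} (there x∈p) = suc (position x∈p)
position {p = outside ∷ p} (there x∈p) = position x∈p

element-position : {p : Subset n} {x : Fin n} (x∈p : x ∈ p) → element p (position x∈p) ≡ x
element-position {p = inside ∷ p} here = refl
element-position {p = inside ∷ p} (there x∈p) = cong suc (element-position x∈p)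
element-position {p = outside ∷ p} (there x∈p) = cong suc (element-position x∈p)

position-injective : {p : Subset n} {x y : Fin n} (x∈p : x ∈ p) (y∈p : y ∈ p) →
  position x∈p ≡ position y∈p → x ≡ y
position-injective x∈p y∈p e =
  trans (sym (element-position x∈p)) (trans (cong (element _) e) (element-position y∈p))

encode : {p : Subset n} {x : Fin n} → Fin k → Fin m → x ∈ p → Fin (k * (m * ∣ p ∣))
encode i u x∈p = combine i (combine u (position x∈p))

encode-injective : {p : Subset n} {x x′ : Fin n} (i i′ : Fin k) (u u′ : Fin m)
  (x∈p : x ∈ p) (x′∈p : x′ ∈ p) →
  encode i u x∈p ≡ encode i′ u′ x′∈p → i ≡ i′ × u ≡ u′ × x ≡ x′
encode-injective i i′ u u′ x∈p x′∈p e with combine-injective i _ i′ _ e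
... | i≡i′ , rest with combine-injective u _ u′ _ rest
...   | u≡u′ , same-position = i≡i′ , u≡u′ , position-injective x∈p x′∈p same-position

product-injection-≤ : (p : Subset k) (q : Subset m) →
  (code : ∀ {x y} → x ∈ p → y ∈ q → Fin t) →
  (∀ {x y x′ y′} (x∈p : x ∈ p) (y∈q : y ∈ q) (x′∈p : x′ ∈ p) (y′∈q : y′ ∈ q) →
     code x∈p y∈q ≡ code x′∈p y′∈q → x ≡ x′ × y ≡ y′) →
  ∣ p ∣ * ∣ q ∣ ≤ t
product-injection-≤ {t = t} p q code code-injective = injective⇒≤ F-injective
  where
  open ≡-Reasoning

  split : Fin (∣ p ∣ * ∣ q ∣) → Fin ∣ p ∣ × Fin ∣ q ∣
  split = remQuot {∣ p ∣} ∣ q ∣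

  F : Fin (∣ p ∣ * ∣ q ∣) → Fin t
  F k = code (element-∈ p (proj₁ (split k))) (element-∈ q (proj₂ (split k)))

  F-injective : Injective _≡_ _≡_ F
  F-injective {k} {l} e = begin
    k                         ≡⟨ sym (combine-remQuot {∣ p ∣} ∣ q ∣ k) ⟩
    uncurry combine (split k) ≡⟨ cong (uncurry combine) same-split ⟩
    uncurry combine (split l) ≡⟨ combine-remQuot {∣ p ∣} ∣ q ∣ l ⟩
    l                         ∎
    where
    same-elements : element p (proj₁ (split k)) ≡ element p (proj₁ (split l))
                  × element q (proj₂ (split k)) ≡ element q (proj₂ (split l))
    same-elements = code-injective _ _ _ _ e
    same-split : split k ≡ split l
    same-split = cong₂ _,_ (element-injective p (proj₁ same-elements))
                           (element-injective q (proj₂ same-elements))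

-- Right cosets of a subgroup H: u ~ v means Hu = Hv, i.e. u·v⁻¹ ∈ H.

module RightCosets (G : FinGroup n) (H : Subset n) (H≤G : IsSubgroup G H) where
  open FinGroup G
  open IsGroup isGroup using (_//_; assoc)
  open ≡-Reasoning

  group : Group 0ℓ 0ℓ
  group = record { isGroup = isGroup }

  open GroupProperties group public
    using (//-rightDividesˡ; x≈z//y; ∙-cancelˡ; ∙-cancelʳ; ⁻¹-injective; ⁻¹-anti-homo-//)

  ∙-closed : ∀ {x y} → x ∈ H → y ∈ H → (x ∙ y) ∈ H
  ∙-closed = proj₁ (proj₂ H≤G)

  ⁻¹-closed : ∀ {x} → x ∈ H → (x ⁻¹) ∈ H
  ⁻¹-closed = proj₂ (proj₂ H≤G)

  infix 4 _~_
  _~_ : Fin n → Fin n → Set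
  u ~ v = (u // v) ∈ H

  ~-sym : ∀ {u v} → u ~ v → v ~ u
  ~-sym {u} {v} u~v = subst (_∈ H) (⁻¹-anti-homo-// u v) (⁻¹-closed u~v)

  ~-trans : ∀ {u v w} → u ~ v → v ~ w → u ~ w
  ~-trans {u} {v} {w} u~v v~w = subst (_∈ H) telescope (∙-closed u~v v~w)
    where
    telescope : (u // v) ∙ (v // w) ≡ u // w
    telescope = begin
      (u // v) ∙ (v // w) ≡⟨ sym (assoc (u // v) v (w ⁻¹)) ⟩
      ((u // v) ∙ v) // w ≡⟨ cong (_// w) (//-rightDividesˡ v u) ⟩
      u // w              ∎

  ∙-~ : ∀ {h u v} → h ∈ H → u ~ v → (h ∙ u) ~ v
  ∙-~ {h} {u} {v} h∈H u~v = subst (_∈ H) (sym (assoc h u (v ⁻¹))) (∙-closed h∈H u~v)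

  factor-~ : ∀ {a b g} → a ∈ H → a ∙ b ≡ g → b ~ g
  factor-~ {a} {b} {g} a∈H ab≡g = ~-sym (subst (_∈ H) (x≈z//y a b g ab≡g) a∈H)

module MinimalLeftComplement
  (G : FinGroup n) (H C B : Subset n) (H≤G : IsSubgroup G H)
  (C⊆H : C ⊆ H) (H⊈C : ¬ H ⊆ C) (minimal : IsMinimalLeftComplement G C B) where

  open FinGroup G
  open IsGroup isGroup using (_//_)
  open RightCosets G H H≤G

  complement : IsLeftComplement G C B
  complement = proj₁ minimal

  Private : Fin n → Fin n → Set
  Private c g = ∀ {a b} → a ∈ C → b ∈ B → a ∙ b ≡ g → a ≡ c

  -- Membership in S·B is decidable, so minimality yields an explicit
  -- element outside (C - c)·B.
  factorable? : (S : Subset n) (g : Fin n) →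
    Dec (∃ λ a → ∃ λ b → a ∈ S × b ∈ B × a ∙ b ≡ g)
  factorable? S g = any? λ a → any? λ b → (a ∈? S) ×-dec (b ∈? B) ×-dec (a ∙ b ≟ g)

  private-element : ∀ {c} → c ∈ C → ∃ (Private c)
  private-element {c} c∈C
    with ¬∀⟶∃¬ n _ (factorable? (C - c)) (proj₂ minimal (C - c) (x∈p⇒p-x⊂p c∈C))
  ... | g , g∉[C-c]B = g , only-c
    where
    only-c : Private c g
    only-c {a} {b} a∈C b∈B ab≡g with a ≟ c
    ... | yes a≡c = a≡c
    ... | no a≢c = ⊥-elim (g∉[C-c]B (a , b , x∈p∧x≢y⇒x∈p-y a∈C a≢c , b∈B , ab≡g))

  -- An element has at most one private owner, since it factors through C·B.
  private-unique : ∀ {c c′ g} → Private c g → Private c′ g → c ≡ c′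
  private-unique {g = g} priv priv′ with complement g
  ... | a , b , a∈C , b∈B , ab≡g = trans (sym (priv a∈C b∈B ab≡g)) (priv′ a∈C b∈B ab≡g)

  Fibre : Fin n → Fin n → Set
  Fibre g b = b ∈ B × b ~ g

  fibre? : ∀ g → Decidable (Fibre g)
  fibre? g b = (b ∈? B) ×-dec ((b // g) ∈? H)

  -- Writing g = a·b with a ∈ C ⊆ H puts b in the fibre.
  fibre-inhabited : ∀ g → ∃ (Fibre g)
  fibre-inhabited g with complement g
  ... | a , b , a∈C , b∈B , ab≡g = b , b∈B , factor-~ (C⊆H a∈C) ab≡g

  fibre-cong : ∀ {g g′ b} → g ~ g′ → Fibre g b → Fibre g′ b
  fibre-cong g~g′ (b∈B , b~g) = b∈B , ~-trans b~g g~g′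

  -- If the fibre of g were {x}, then every h·x (h ∈ H) factors as a·x
  -- with a ∈ C, so H ⊆ C.
  singleton-fibre⇒H⊆C : ∀ {g x} → Fibre g x → (∀ {y} → Fibre g y → y ≡ x) → H ⊆ C
  singleton-fibre⇒H⊆C {g} {x} (_ , x~g) only-x {h} h∈H with complement (h ∙ x)
  ... | a , b , a∈C , b∈B , ab≡hx = subst (_∈ C) (∙-cancelʳ x a h ax≡hx) a∈C
    where
    b≡x : b ≡ x
    b≡x = only-x (b∈B , ~-trans (factor-~ (C⊆H a∈C) ab≡hx) (∙-~ h∈H x~g))
    ax≡hx : a ∙ x ≡ h ∙ x
    ax≡hx = subst (λ y → a ∙ y ≡ h ∙ x) b≡x ab≡hx

  another-in-fibre : ∀ {g x} → Fibre g x → ∃ λ y → Fibre g y × y ≢ x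
  another-in-fibre {g} {x} x∈ with any? (λ y → fibre? g y ×-dec ¬? (y ≟ x))
  ... | yes found = found
  ... | no none = ⊥-elim (H⊈C (singleton-fibre⇒H⊆C x∈ only-x))
    where
    only-x : ∀ {y} → Fibre g y → y ≡ x
    only-x {y} y∈ = decidable-stable (y ≟ x) (λ y≢x → none (y , y∈ , y≢x))

  first : Fin n → Fin n
  first g = proj₁ (least (fibre? g) (fibre-inhabited g))

  first-least : ∀ g → IsLeast (Fibre g) (first g)
  first-least g = proj₂ (least (fibre? g) (fibre-inhabited g))

  Other : Fin n → Fin n → Set
  Other g y = Fibre g y × y ≢ first g

  other? : ∀ g → Decidable (Other g)
  other? g y = fibre? g y ×-dec ¬? (y ≟ first g)

  second : Fin n → Fin n
  second g = proj₁ (least (other? g) (another-in-fibre (proj₁ (first-least g))))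

  second-least : ∀ g → IsLeast (Other g) (second g)
  second-least g = proj₂ (least (other? g) (another-in-fibre (proj₁ (first-least g))))

  first-cong : ∀ {g g′} → g ~ g′ → first g ≡ first g′
  first-cong g~g′ =
    least-unique (fibre-cong g~g′) (fibre-cong (~-sym g~g′)) (first-least _) (first-least _)

  second-cong : ∀ {g g′} → g ~ g′ → second g ≡ second g′
  second-cong {g} {g′} g~g′ = least-unique (other-cong g~g′) (other-cong (~-sym g~g′))
                                           (second-least g) (second-least g′)
    where
    other-cong : ∀ {u v y} → u ~ v → Other u y → Other v y
    other-cong u~v (y∈ , y≢) = fibre-cong u~v y∈ , λ y≡ → y≢ (trans y≡ (sym (first-cong u~v)))

  select : Fin n → Fin 2 → Fin n
  select g zero = first g
  select g (suc zero) = second g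

  select-fibre : ∀ g i → Fibre g (select g i)
  select-fibre g zero = proj₁ (first-least g)
  select-fibre g (suc zero) = proj₁ (proj₁ (second-least g))

  select-cong : ∀ {g g′} → g ~ g′ → ∀ i → select g i ≡ select g′ i
  select-cong g~g′ zero = first-cong g~g′
  select-cong g~g′ (suc zero) = second-cong g~g′

  -- Step (3).  If g is private to c and b ∈ B with g·b⁻¹ ∈ C, then
  -- g = (g·b⁻¹)·b forces g·b⁻¹ = c; so this fails for first g or second g.

  private-quotient : ∀ {c g b} → Private c g → b ∈ B → (g // b) ∈ C → g // b ≡ c
  private-quotient {g = g} {b} priv b∈B gb∈C = priv gb∈C b∈B (//-rightDividesˡ b g)

  escape : ∀ {c g} → Private c g → ∃ λ i → (g // select g i) ∉ C
  escape {g = g} priv with (g // first g) ∈? C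
  ... | no first∉C = zero , first∉C
  ... | yes first∈C = suc zero , λ second∈C →
          proj₂ (proj₁ (second-least g))
            (⁻¹-injective (∙-cancelˡ g _ _
              (trans (private-quotient priv (proj₁ (select-fibre g (suc zero))) second∈C)
                     (sym (private-quotient priv (proj₁ (select-fibre g zero)) first∈C)))))

  witness : ∀ {c} → c ∈ C → Fin n
  witness c∈C = proj₁ (private-element c∈C)

  side : ∀ {c} → c ∈ C → Fin 2
  side c∈C = proj₁ (escape (proj₂ (private-element c∈C)))

  bridge : ∀ {c} → c ∈ C → Fin n
  bridge c∈C = select (witness c∈C) (side c∈C)

  bridge~witness : ∀ {c} (c∈C : c ∈ C) → bridge c∈C ~ witness c∈C
  bridge~witness c∈C = proj₂ (select-fibre (witness c∈C) (side c∈C))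

  leftover-∈ : ∀ {c} (c∈C : c ∈ C) → (witness c∈C // bridge c∈C) ∈ H ─ C
  leftover-∈ c∈C =
    x∈p∧x∉q⇒x∈p─q (~-sym (bridge~witness c∈C)) (proj₂ (escape (proj₂ (private-element c∈C))))

  code : ∀ {h c} → h ∈ H → c ∈ C → Fin (2 * (n * ∣ H ─ C ∣))
  code {h} h∈H c∈C = encode (side c∈C) (h ∙ bridge c∈C) (leftover-∈ c∈C)

  -- h·b determines the coset Hg, hence b; then h, g and finally c follow.
  code-injective : ∀ {h c h′ c′} (h∈H : h ∈ H) (c∈C : c ∈ C) (h′∈H : h′ ∈ H) (c′∈C : c′ ∈ C) →
    code h∈H c∈C ≡ code h′∈H c′∈C → h ≡ h′ × c ≡ c′
  code-injective {h} {c} {h′} {c′} h∈H c∈C h′∈H c′∈C same-code =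
    ∙-cancelʳ b h h′ (trans same-product (cong (h′ ∙_) (sym same-bridge))) ,
    private-unique (proj₂ (private-element c∈C))
                   (subst (Private c′) (sym same-witness) (proj₂ (private-element c′∈C)))
    where
    g g′ b b′ : Fin n
    g = witness c∈C
    g′ = witness c′∈C
    b = bridge c∈C
    b′ = bridge c′∈C

    same-parts : side c∈C ≡ side c′∈C × h ∙ b ≡ h′ ∙ b′ × g // b ≡ g′ // b′
    same-parts = encode-injective _ _ _ _ (leftover-∈ c∈C) (leftover-∈ c′∈C) same-code

    same-product : h ∙ b ≡ h′ ∙ b′
    same-product = proj₁ (proj₂ same-parts)

    same-coset : g ~ g′
    same-coset = ~-trans (~-sym (∙-~ h∈H (bridge~witness c∈C)))
                         (subst (_~ g′) (sym same-product) (∙-~ h′∈H (bridge~witness c′∈C)))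

    same-bridge : b ≡ b′
    same-bridge = trans (select-cong same-coset (side c∈C)) (cong (select g′) (proj₁ same-parts))

    same-witness : g ≡ g′
    same-witness = ∙-cancelʳ (b ⁻¹) g g′
      (trans (proj₂ (proj₂ same-parts)) (cong (g′ //_) (sym same-bridge)))

  bound : ∣ H ∣ * ∣ C ∣ ≤ 2 * (n * ∣ H ─ C ∣)
  bound = product-injection-≤ H C code code-injective

opposite : FinGroup n → FinGroup n
opposite G = record { _∙_ = flip _∙_ ; ε = ε ; _⁻¹ = _⁻¹ ; isGroup = Flip.isGroup isGroup }
  where open FinGroup G

subgroup-opposite : (G : FinGroup n) {H : Subset n} → IsSubgroup G H → IsSubgroup (opposite G) H
subgroup-opposite G (ε∈H , ∙-closed , ⁻¹-closed) = ε∈H , flip ∙-closed , ⁻¹-closed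

minimal-right⇒left-opposite : (G : FinGroup n) {C B : Subset n} →
  IsMinimalRightComplement G C B → IsMinimalLeftComplement (opposite G) C B
minimal-right⇒left-opposite {n} G (complement , minimal) =
  (λ g → swap (complement g)) ,
  (λ C′ C′⊂C left → minimal C′ C′⊂C (λ g → swap (left g)))
  where
  swap : ∀ {A A′ : Subset n} {R : Fin n → Fin n → Set} →
    (∃ λ x → ∃ λ y → x ∈ A × y ∈ A′ × R x y) → ∃ λ y → ∃ λ x → y ∈ A′ × x ∈ A × R x y
  swap (x , y , x∈A , y∈A′ , Rxy) = y , x , y∈A′ , x∈A , Rxy

divide-by-order : ∀ h c i d → c < h → h * c ≤ 2 * ((i * h) * d) → c ≤ 2 * i * d
divide-by-order h c i d c<h hc≤2ihd =
  ℕ.*-cancelˡ-≤ h ⦃ >-nonZero (ℕ.≤-<-trans z≤n c<h) ⦄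
    (subst (h * c ≤_) (rearrange h i d) hc≤2ihd)
  where
  rearrange : ∀ h i d → 2 * ((i * h) * d) ≡ h * (2 * i * d)
  rearrange = solve-∀

proposition2p17 : ∀ {n : ℕ} (G : FinGroup n) (H C : Subset n) →
    IsSubgroup G H →
    (index : ℕ) → index * ∣ H ∣ ≡ n →
    C ⊆ H →
    ∣ C ∣ < ∣ H ∣ →
    2 * index * ∣ H ─ C ∣ < ∣ C ∣ →
    ¬ IsMinimalComplement G C
proposition2p17 {n} G H C H≤G index index*∣H∣≡n C⊆H C<H big (_ , B , _ , minimal) =
  ℕ.<⇒≱ big (divide-by-order (∣ H ∣) (∣ C ∣) index (∣ H ─ C ∣) C<H
    (subst (λ order → ∣ H ∣ * ∣ C ∣ ≤ 2 * (order * ∣ H ─ C ∣)) (sym index*∣H∣≡n) (bound minimal)))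
  where
  H⊈C : ¬ H ⊆ C
  H⊈C H⊆C = ℕ.<⇒≱ C<H (p⊆q⇒∣p∣≤∣q∣ H⊆C)

  bound : IsMinimalLeftComplement G C B ⊎ IsMinimalRightComplement G C B →
          ∣ H ∣ * ∣ C ∣ ≤ 2 * (n * ∣ H ─ C ∣)
  bound (inj₁ left) = MinimalLeftComplement.bound G H C B H≤G C⊆H H⊈C left
  bound (inj₂ right) = MinimalLeftComplement.bound (opposite G) H C B
    (subgroup-opposite G H≤G) C⊆H H⊈C (minimal-right⇒left-opposite G right)
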